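{- For every partition $\mu$ of an integer $w>0$, with conjugate partition $\mu'$, one has the identity of rational functions \[ \mathrm{QEhr}_\mu(z^{ -1},q^{ -1})=(-1)^{w+1}z^2\,\mathrm{QEhr}_{\mu'}(z,q). \]
   Context: For a partition $\mu$ of $w$, $\mathrm{QEhr}_\mu(z,q)=\sum_{h\geqslant 0}s_\mu(q^{ -h},q^{ -h+2},\ldots,q^{h})\,z^h$, where $s_\mu(q^{ -h},\ldots,q^h)$ is the Schur polynomial in $h+1$ variables evaluated at $q^{ -h+2j}$, $0\le j\le h$. It is known that this series is the expansion of the rational function \[ \frac{\sum_{T\in\mathsf{SYT}(\mu)}q^{ -2\mathsf{maj}(T)}(zq^w)^{\mathsf{des}(T)}}{\prod_{i=0}^{w}(1-q^{w-2i}z)}, \] where $\mathsf{SYT}(\mu)$ is the set of standard Young tableaux of shape $\mu$, $i$ is a descent of $T$ if $i+1$ lies in a strictly lower row than $i$ (English convention), $\mathsf{des}(T)$ is the number of descents and $\mathsf{maj}(T)$ their sum; $\mathrm{QEhr}_\mu(z^{ -1},q^{ -1})$ denotes this rational function with $z,q$ replaced by $z^{ -1},q^{ -1}$. -}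

module Defs where

open import Data.Bool using (Bool; true; false; if_then_else_)
open import Data.Nat as ℕ using (ℕ; zero; suc; _<_; _≤_; _≥_; _<?_; _≤?_)
open import Data.Integer as ℤ using (ℤ; +_; -[1+_])
open import Data.Rational as ℚ using (ℚ; 0ℚ; 1ℚ; _+_; _*_; _-_; 1/_; _÷_; NonZero; mkℚ)
open import Data.Integer.Base using (+[1+_])
open import Data.List using (List; []; _∷_; map; concat; concatMap; filter; length; applyUpTo; upTo; zip; foldr)
open import Data.List.Relation.Unary.All using (All; all?)
open import Data.List.Relation.Unary.Linked using (Linked; linked?)
open import Data.List.Membership.DecPropositional ℕ._≟_ using (_∈_; _∈?_)
open import Data.Nat.ListAction using (sum)
open import Data.Product using (_×_; _,_; uncurry)
open import Relation.Nullary using (Dec; does)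
open import Relation.Nullary.Decidable using (_×-dec_)
open import Relation.Binary.PropositionalEquality using (_≡_; _≢_)

IsPartition : ℕ → List ℕ → Set
IsPartition w μ = Linked _≥_ μ × All (λ m → 0 < m) μ × sum μ ≡ w

firstPart : List ℕ → ℕ
firstPart []      = 0
firstPart (m ∷ _) = m

conjugate : List ℕ → List ℕ
conjugate μ = applyUpTo (λ j → length (filter (λ m → suc j ≤? m) μ)) (firstPart μ)

-- Tableaux of shape μ: lists of rows (English convention, row 0 on top).

Tableau : Set
Tableau = List (List ℕ)

listsOf : ℕ → List ℕ → List (List ℕ)
listsOf zero    xs = [] ∷ []
listsOf (suc l) xs = concatMap (λ x → map (x ∷_) (listsOf l xs)) xs

fillings : ℕ → List ℕ → List Tableau
fillings w []      = [] ∷ []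
fillings w (l ∷ μ) =
  concatMap (λ r → map (r ∷_) (fillings w μ)) (listsOf l (applyUpTo suc w))

ColsIncr : List ℕ → List ℕ → Set
ColsIncr r r' = All (λ p → Data.Product.proj₁ p < Data.Product.proj₂ p) (zip r r')

colsIncr? : ∀ r r' → Dec (ColsIncr r r')
colsIncr? r r' = all? (λ p → Data.Product.proj₁ p <? Data.Product.proj₂ p) (zip r r')

-- standardness of a filling of shape μ with entries in {1..w}:
-- rows strictly increasing, columns strictly increasing, and every
-- k ∈ {1..w} occurs (with |μ| = w cells this means each occurs exactly once)
IsStandard : ℕ → Tableau → Set
IsStandard w T = All (Linked _<_) T × Linked ColsIncr T
               × All (λ k → k ∈ concat T) (applyUpTo suc w)

isStandard? : ∀ w T → Dec (IsStandard w T)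
isStandard? w T = all? (linked? _<?_) T ×-dec linked? colsIncr? T
                  ×-dec all? (λ k → k ∈? concat T) (applyUpTo suc w)

SYT : ℕ → List ℕ → List Tableau
SYT w μ = filter (isStandard? w) (fillings w μ)

rowOf : Tableau → ℕ → ℕ
rowOf []      k = 0
rowOf (r ∷ T) k = if does (k ∈? r) then 0 else suc (rowOf T k)

descents : ℕ → Tableau → List ℕ
descents w T = filter (λ i → rowOf T i <? rowOf T (suc i)) (applyUpTo suc (w ℕ.∸ 1))

des : ℕ → Tableau → ℕ
des w T = length (descents w T)

maj : ℕ → Tableau → ℕ
maj w T = sum (descents w T)

_^ℕ_ : ℚ → ℕ → ℚ
q ^ℕ zero  = 1ℚ
q ^ℕ suc n = q * (q ^ℕ n)

_^ℤ_ : (q : ℚ) → .{{_ : NonZero q}} → ℤ → ℚ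
q ^ℤ (+ n)      = q ^ℕ n
q ^ℤ (-[1+ n ]) = (1/ q) ^ℕ suc n

sumℚ : List ℚ → ℚ
sumℚ = foldr _+_ 0ℚ

prodℚ : List ℚ → ℚ
prodℚ = foldr _*_ 1ℚ

inv-nonZero : ∀ p .{{_ : NonZero p}} → NonZero (1/ p)
inv-nonZero (mkℚ +[1+ n ] d _) = _
inv-nonZero (mkℚ -[1+ n ] d _) = _

-- The rational function QEhr_μ(z,q) for μ ⊢ w:
--   Σ_{T ∈ SYT(μ)} q^{-2 maj T} (z q^w)^{des T}  /  ∏_{i=0}^{w} (1 - q^{w-2i} z)

QEhrNum : ℕ → List ℕ → (z q : ℚ) → .{{_ : NonZero q}} → ℚ
QEhrNum w μ z q =
  sumℚ (map (λ T → (q ^ℤ (ℤ.- (+ (2 ℕ.* maj w T)))) * ((z * (q ^ℕ w)) ^ℕ des w T))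
            (SYT w μ))

QEhrDen : ℕ → (z q : ℚ) → .{{_ : NonZero q}} → ℚ
QEhrDen w z q = prodℚ (map (λ i → 1ℚ - (q ^ℤ ((+ w) ℤ.- (+ (2 ℕ.* i)))) * z) (upTo (suc w)))

-- value of the rational function at a point where the denominator is nonzero
QEhr : (w : ℕ) → List ℕ → (z q : ℚ) → .{{_ : NonZero q}} → QEhrDen w z q ≢ 0ℚ → ℚ
QEhr w μ z q h = _÷_ (QEhrNum w μ z q) (QEhrDen w z q) {{ℚ.≢-nonZero h}}

-- Transposition T ↦ Tᵗ is a bijection from SYT(μ) onto SYT(μ′). In a standard tableau x + 1 lies
-- either strictly below x or strictly to the right of x, and never both; transposition swaps the
-- two cases, so the descent set of Tᵗ is the complement of that of T in {1, …, w − 1}. Hence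
-- des T + des Tᵗ = w − 1 and maj T + maj Tᵗ = w(w − 1)/2, which turns z^(w−1) times the summand of
-- T in the numerator of QEhr_μ(z⁻¹, q⁻¹) into the summand of Tᵗ in the numerator of QEhr_μ′(z, q).
-- In the denominator 1 − q^(−e) z⁻¹ = (−z⁻¹) q^(−e) (1 − q^e z), and the exponents e = w − 2i
-- (0 ≤ i ≤ w) sum to 0, so the denominator gets multiplied by (−z⁻¹)^(w+1). Dividing leaves the
-- factor z^(w+1) / z^(w−1) = z², with sign (−1)^(w+1).

module Submission where

open import Defs

open import Algebra.Bundles using (CommutativeRing)
open import Data.Bool using (not)
open import Data.Empty using (⊥-elim)
open import Data.Integer as ℤ using (ℤ; +_; -[1+_]; _⊖_)
import Data.Integer.Properties as ℤ
open import Data.List as List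
  using (List; []; [_]; _∷_; _++_; map; concat; concatMap; filter; length; applyUpTo; upTo; zip; replicate;
         cartesianProductWith; mapMaybe)
open import Data.List.Properties
  using (∷-injective; length-++; length-applyUpTo; length-upTo; length-replicate; filter-accept; filter-reject;
         filter-all; map-cong; map-cong-local; map-∘; map-id; map-upTo; map-applyUpTo; applyUpTo-∷ʳ)
open import Data.List.Membership.Propositional using (_∈_; _∉_)
open import Data.List.Membership.Propositional.Properties
  using (∈-++⁺ˡ; ∈-++⁺ʳ; ∈-concat⁻′; ∈-map⁺; ∈-map⁻; ∈-filter⁺; ∈-filter⁻; ∈-applyUpTo⁺; ∈-applyUpTo⁻;
         ∈-cartesianProductWith⁺; ∈-cartesianProductWith⁻)
open import Data.List.Membership.Propositional.Properties.WithK using (unique∧set⇒bag)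
open import Data.List.Relation.Binary.BagAndSetEquality using (∼bag⇒↭)
open import Data.List.Relation.Binary.Permutation.Propositional using (_↭_; ↭-refl; ↭-prep; ↭-trans; ↭⇒↭ₛ)
open import Data.List.Relation.Binary.Permutation.Propositional.Properties
  using (↭-length; shift) renaming (map⁺ to ↭-map⁺)
open import Data.List.Relation.Binary.Permutation.Setoid.Properties using (foldr-commMonoid)
open import Data.List.Relation.Unary.All as All using (All; []; _∷_)
import Data.List.Relation.Unary.All.Properties as All
open import Data.List.Relation.Unary.AllPairs using (AllPairs; []; _∷_)
open import Data.List.Relation.Unary.Any as Any using (here; there)
open import Data.List.Relation.Unary.Linked as Linked using (Linked; []; [-]; _∷_)
import Data.List.Relation.Unary.Linked.Properties as Linked
open import Data.List.Relation.Unary.Unique.Propositional using (Unique)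
import Data.List.Relation.Unary.Unique.Propositional.Properties as Unique
open import Data.Maybe using (Maybe; just; nothing; maybe′; _>>=_)
open import Data.Maybe.Properties using (just-injective)
open import Data.Nat as ℕ using (ℕ; zero; suc; _≤_; _<_; _≥_; _≤?_; _<?_; z≤n; s≤s)
import Data.Nat.Properties as ℕ
open import Data.Nat.ListAction using (sum)
open import Data.Nat.ListAction.Properties using (sum-++; sum-↭)
import Data.Nat.Tactic.RingSolver as ℕ-Solver
open import Data.List.Membership.DecPropositional ℕ._≟_ using (_∈?_)
open import Data.Product using (∃; ∃₂; _×_; _,_; proj₁; proj₂)
open import Data.Rational as ℚ using (ℚ; 0ℚ; 1ℚ; _+_; _*_; _-_; -_; 1/_; _÷_; NonZero)
import Data.Rational.Properties as ℚ
open import Data.Sum using (_⊎_; inj₁; inj₂)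
open import Function using (_∘_; id)
open import Function.Bundles using (mk⇔)
open import Relation.Binary.Definitions using (DecidableEquality; tri<; tri≈; tri>)
open import Relation.Binary.PropositionalEquality
  using (_≡_; _≢_; refl; sym; trans; cong; cong₂; subst; setoid; module ≡-Reasoning)
open import Relation.Nullary using (¬_; Dec; yes; no; does; ¬?)
open import Relation.Unary using (Decidable)
import Tactic.RingSolver.Core.AlmostCommutativeRing as ACR
open import Tactic.RingSolver using (solve-∀)

open import Algebra.Properties.CommutativeSemiring.Exp (CommutativeRing.commutativeSemiring ℚ.+-*-commutativeRing)
  using (_^_; ^-homo-*; ^-assocʳ; ^-distrib-*)

private variable
  A : Set
  x y : A
  xs ys : List A
  i i′ j j′ k n : ℕ
  r s : List ℕ
  T S : Tableau

infixl 9 _‼_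
_‼_ : List A → ℕ → Maybe A
[]       ‼ _     = nothing
(x ∷ xs) ‼ zero  = just x
(x ∷ xs) ‼ suc i = xs ‼ i

‼⇒∈ : xs ‼ i ≡ just x → x ∈ xs
‼⇒∈ {xs = _ ∷ _}  {i = zero}  refl = here refl
‼⇒∈ {xs = _ ∷ xs} {i = suc i} eq   = there (‼⇒∈ {xs = xs} eq)

∈⇒‼ : x ∈ xs → ∃ λ i → xs ‼ i ≡ just x
∈⇒‼ (here refl)  = zero , refl
∈⇒‼ (there x∈xs) = let i , eq = ∈⇒‼ x∈xs in suc i , eq

‼-All : {P : A → Set} → All P xs → xs ‼ i ≡ just x → P x
‼-All {i = zero}  (px ∷ _)   refl = px
‼-All {i = suc i} (_  ∷ pxs) eq   = ‼-All pxs eq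

Linked-‼ : {R : A → A → Set} → (∀ {i x y} → xs ‼ i ≡ just x → xs ‼ suc i ≡ just y → R x y) → Linked R xs
Linked-‼ {xs = []}         _ = []
Linked-‼ {xs = x ∷ []}     _ = [-]
Linked-‼ {xs = x ∷ y ∷ xs} p = p {zero} refl refl ∷ Linked-‼ (λ {i} → p {suc i})

AllPairs-‼ : {R : A → A → Set} → AllPairs R xs → xs ‼ i ≡ just x → xs ‼ j ≡ just y → i < j → R x y
AllPairs-‼ {i = zero}  {j = suc j} (rx ∷ _)   refl ey _         = ‼-All rx ey
AllPairs-‼ {i = suc i} {j = suc j} (_  ∷ rxs) ex   ey (s≤s i<j) = AllPairs-‼ rxs ex ey i<j

Unique-‼-injective : Unique xs → xs ‼ i ≡ just x → xs ‼ j ≡ just x → i ≡ j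
Unique-‼-injective {i = i} {j = j} u ex ey with ℕ.<-cmp i j
... | tri< i<j _ _ = ⊥-elim (AllPairs-‼ u ex ey i<j refl)
... | tri≈ _ i≡j _ = i≡j
... | tri> _ _ j<i = ⊥-elim (AllPairs-‼ u ey ex j<i refl)

‼-ext : (∀ i → xs ‼ i ≡ ys ‼ i) → xs ≡ ys
‼-ext {xs = []}     {ys = []}     _  = refl
‼-ext {xs = []}     {ys = _ ∷ _}  eq with eq 0
... | ()
‼-ext {xs = _ ∷ _}  {ys = []}     eq with eq 0
... | ()
‼-ext {xs = _ ∷ _}  {ys = _ ∷ _}  eq = cong₂ _∷_ (just-injective (eq 0)) (‼-ext (eq ∘ suc))

‼-just⇒< : xs ‼ i ≡ just x → i < length xs
‼-just⇒< {xs = _ ∷ _}  {i = zero}  _  = s≤s z≤n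
‼-just⇒< {xs = _ ∷ xs} {i = suc i} eq = s≤s (‼-just⇒< {xs = xs} eq)

<⇒‼-just : i < length xs → ∃ λ x → xs ‼ i ≡ just x
<⇒‼-just {i = zero}  {xs = x ∷ _}  _         = x , refl
<⇒‼-just {i = suc i} {xs = _ ∷ xs} (s≤s i<n) = <⇒‼-just {xs = xs} i<n

‼-nothing⇒≤ : xs ‼ i ≡ nothing → length xs ≤ i
‼-nothing⇒≤ {xs = []}                 _  = z≤n
‼-nothing⇒≤ {xs = _ ∷ xs} {i = suc i} eq = s≤s (‼-nothing⇒≤ {xs = xs} eq)

≤⇒‼-nothing : length xs ≤ i → xs ‼ i ≡ nothing
≤⇒‼-nothing {xs = []}                 _         = refl
≤⇒‼-nothing {xs = _ ∷ xs} {i = suc i} (s≤s n≤i) = ≤⇒‼-nothing {xs = xs} n≤i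

‼-applyUpTo : (f : ℕ → A) → i < n → applyUpTo f n ‼ i ≡ just (f i)
‼-applyUpTo {i = zero}  {n = suc n} f _         = refl
‼-applyUpTo {i = suc i} {n = suc n} f (s≤s i<n) = ‼-applyUpTo (f ∘ suc) i<n

All-zip-‼ : {P : ℕ × ℕ → Set} → All P (zip r s) → r ‼ j ≡ just x → s ‼ j ≡ just y → P (x , y)
All-zip-‼ {r = _ ∷ _}  {s = _ ∷ _}  {j = zero}  (p ∷ _)  refl refl = p
All-zip-‼ {r = _ ∷ r}  {s = _ ∷ s}  {j = suc j} (_ ∷ ps) ex   ey   = All-zip-‼ {r = r} {s = s} ps ex ey

‼-All-zip : {P : ℕ × ℕ → Set} → (∀ {j x y} → r ‼ j ≡ just x → s ‼ j ≡ just y → P (x , y)) → All P (zip r s)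
‼-All-zip {r = []}             _ = []
‼-All-zip {r = _ ∷ _} {s = []} _ = []
‼-All-zip {r = _ ∷ _} {s = _ ∷ _} p = p {zero} refl refl ∷ ‼-All-zip (λ {j} → p {suc j})

Unique-++⁻ : Unique (xs ++ ys) → Unique xs × Unique ys
Unique-++⁻ {xs = []}     u           = [] , u
Unique-++⁻ {xs = x ∷ xs} (x∉ ∷ u) =
  let uxs , uys = Unique-++⁻ {xs = xs} u in (All.++⁻ˡ xs x∉ ∷ uxs) , uys

Unique-++-disjoint : Unique (xs ++ ys) → x ∈ xs → x ∉ ys
Unique-++-disjoint {xs = _ ∷ xs} (x∉ ∷ _) (here refl) x∈ys = All.lookup x∉ (∈-++⁺ʳ xs x∈ys) refl
Unique-++-disjoint {xs = _ ∷ xs} (_  ∷ u) (there x∈xs)     = Unique-++-disjoint {xs = xs} u x∈xs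

Unique-map-retraction : ∀ {B : Set} {f : A → B} {g : B → A} →
                        (∀ {x} → x ∈ xs → g (f x) ≡ x) → Unique xs → Unique (map f xs)
Unique-map-retraction {xs = []}                 _  []         = []
Unique-map-retraction {xs = x ∷ xs} {g = g} gf (x∉xs ∷ u) =
  All.map⁺ (All.tabulate λ y∈xs fx≡fy →
    All.lookup x∉xs y∈xs (trans (sym (gf (here refl))) (trans (cong g fx≡fy) (gf (there y∈xs)))))
  ∷ Unique-map-retraction {g = g} (gf ∘ there) u

module _ {A : Set} (_≟_ : DecidableEquality A) where

  private
    _without_ : List A → A → List A
    xs without y = filter (λ x → ¬? (x ≟ y)) xs

  length-without-unique : ∀ {xs} y → Unique xs → length xs ≤ suc (length (xs without y))
  length-without-unique {[]}     y _ = z≤n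
  length-without-unique {x ∷ xs} y (x∉xs ∷ u) with x ≟ y
  ... | yes refl = s≤s (ℕ.≤-reflexive (cong length (sym (filter-all (λ x → ¬? (x ≟ y)) (All.map (_∘ sym) x∉xs)))))
  ... | no  _    = s≤s (length-without-unique y u)

  without-⊆ : ∀ {xs y ys} → All (_∈ y ∷ ys) xs → All (_∈ ys) (xs without y)
  without-⊆ xs⊆ = All.tabulate λ x∈ →
    let x∈xs , x≢y = ∈-filter⁻ (λ x → ¬? (x ≟ _)) x∈ in Any.tail x≢y (All.lookup xs⊆ x∈xs)

  Unique-length-≤ : ∀ {xs ys} → Unique xs → All (_∈ ys) xs → length xs ≤ length ys
  Unique-length-≤ {[]}              _ _          = z≤n
  Unique-length-≤ {_ ∷ _} {[]}      _ (() ∷ _)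
  Unique-length-≤ {ys = y ∷ ys}     u xs⊆ys      = ℕ.≤-trans (length-without-unique y u)
    (s≤s (Unique-length-≤ (Unique.filter⁺ (λ x → ¬? (x ≟ y)) u) (without-⊆ xs⊆ys)))

  pigeonhole : ∀ {xs ys} → Unique xs → All (_∈ ys) xs → length ys ≤ length xs → Unique ys
  pigeonhole {ys = []}     _ _   _     = []
  pigeonhole {ys = y ∷ ys} u xs⊆ ys≤xs =
    All.tabulate y∉ys ∷ pigeonhole (Unique.filter⁺ (λ x → ¬? (x ≟ y)) u) (without-⊆ xs⊆)
                          (ℕ.≤-pred (ℕ.≤-trans ys≤xs (length-without-unique y u)))
    where
    y∉ys : ∀ {z} → z ∈ ys → y ≢ z
    y∉ys z∈ys refl = ℕ.<-irrefl refl (ℕ.≤-trans (s≤s (Unique-length-≤ u (All.map drop-y xs⊆))) ys≤xs)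
      where
      drop-y : ∀ {x} → x ∈ y ∷ ys → x ∈ ys
      drop-y (here refl) = z∈ys
      drop-y (there x∈)  = x∈

length-filter-mono : {P Q : A → Set} (P? : Decidable P) (Q? : Decidable Q) →
                     (∀ {x} → P x → Q x) → ∀ xs → length (filter P? xs) ≤ length (filter Q? xs)
length-filter-mono P? Q? P⇒Q []       = z≤n
length-filter-mono P? Q? P⇒Q (x ∷ xs) with P? x | Q? x
... | yes _ | yes _  = s≤s (length-filter-mono P? Q? P⇒Q xs)
... | yes p | no ¬q  = ⊥-elim (¬q (P⇒Q p))
... | no  _ | yes _  = ℕ.m≤n⇒m≤1+n (length-filter-mono P? Q? P⇒Q xs)
... | no  _ | no  _  = length-filter-mono P? Q? P⇒Q xs

filter-complement-↭ : {P Q : A → Set} (P? : Decidable P) (Q? : Decidable Q) →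
                      (∀ {x} → x ∈ xs → does (Q? x) ≡ not (does (P? x))) → filter P? xs ++ filter Q? xs ↭ xs
filter-complement-↭ {xs = []}     P? Q? _ = ↭-refl
filter-complement-↭ {xs = x ∷ xs} P? Q? complement with P? x | Q? x | complement (here refl)
... | yes _ | no  _ | _ = ↭-prep x (filter-complement-↭ P? Q? (complement ∘ there))
... | no  _ | yes _ | _ = ↭-trans (shift x (filter P? xs) (filter Q? xs))
                                  (↭-prep x (filter-complement-↭ P? Q? (complement ∘ there)))

concatMap-∷ : ∀ (xs : List A) yss → concatMap (λ x → map (x ∷_) yss) xs ≡ cartesianProductWith List._∷_ xs yss
concatMap-∷ []       yss = refl
concatMap-∷ (x ∷ xs) yss = cong (map (x ∷_) yss ++_) (concatMap-∷ xs yss)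

length-concat : ∀ (xss : List (List A)) → length (concat xss) ≡ sum (map length xss)
length-concat []         = refl
length-concat (xs ∷ xss) = trans (length-++ xs) (cong (length xs ℕ.+_) (length-concat xss))

does-xor : {P Q : Set} (P? : Dec P) (Q? : Dec Q) → ¬ (P × Q) → P ⊎ Q → does Q? ≡ not (does P?)
does-xor (yes p)  (yes q)  ¬p×q _        = ⊥-elim (¬p×q (p , q))
does-xor (yes _)  (no  _)  _    _        = refl
does-xor (no  _)  (yes _)  _    _        = refl
does-xor (no  ¬p) (no  _)  _    (inj₁ p) = ⊥-elim (¬p p)
does-xor (no  _)  (no  ¬q) _    (inj₂ q) = ⊥-elim (¬q q)

oneTo : ℕ → List ℕ
oneTo = applyUpTo suc

oneTo-unique : ∀ n → Unique (oneTo n)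
oneTo-unique n = Unique.applyUpTo⁺₁ suc n λ i<j _ → ℕ.<⇒≢ i<j ∘ ℕ.suc-injective

2*sum-oneTo : ∀ n → 2 ℕ.* sum (oneTo n) ≡ n ℕ.* suc n
2*sum-oneTo zero    = refl
2*sum-oneTo (suc n) = begin
  2 ℕ.* sum (oneTo (suc n))                  ≡⟨ cong (λ xs → 2 ℕ.* sum xs) (applyUpTo-∷ʳ suc n) ⟨
  2 ℕ.* sum (oneTo n ++ [ suc n ])           ≡⟨ cong (2 ℕ.*_) (sum-++ (oneTo n) [ suc n ]) ⟩
  2 ℕ.* (sum (oneTo n) ℕ.+ (suc n ℕ.+ 0))    ≡⟨ ℕ.*-distribˡ-+ 2 (sum (oneTo n)) _ ⟩
  2 ℕ.* sum (oneTo n) ℕ.+ 2 ℕ.* (suc n ℕ.+ 0) ≡⟨ cong (ℕ._+ 2 ℕ.* (suc n ℕ.+ 0)) (2*sum-oneTo n) ⟩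
  n ℕ.* suc n ℕ.+ 2 ℕ.* (suc n ℕ.+ 0)        ≡⟨ n[1+n]+2[1+n]≡[1+n][2+n] n ⟩
  suc n ℕ.* suc (suc n)                      ∎
  where
  open ≡-Reasoning
  n[1+n]+2[1+n]≡[1+n][2+n] : ∀ n → n ℕ.* suc n ℕ.+ 2 ℕ.* (suc n ℕ.+ 0) ≡ suc n ℕ.* suc (suc n)
  n[1+n]+2[1+n]≡[1+n][2+n] = ℕ-Solver.solve-∀

sum-map-*ˡ : ∀ c xs → sum (map (c ℕ.*_) xs) ≡ c ℕ.* sum xs
sum-map-*ˡ c []       = sym (ℕ.*-zeroʳ c)
sum-map-*ˡ c (x ∷ xs) = trans (cong (c ℕ.* x ℕ.+_) (sum-map-*ˡ c xs)) (sym (ℕ.*-distribˡ-+ c x (sum xs)))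

entry : Tableau → ℕ → ℕ → Maybe ℕ
entry []      _       _ = nothing
entry (r ∷ T) zero    j = r ‼ j
entry (r ∷ T) (suc i) j = entry T i j

entry-via-row : entry T i j ≡ (T ‼ i >>= _‼ j)
entry-via-row {T = []}                = refl
entry-via-row {T = r ∷ T} {i = zero}  = refl
entry-via-row {T = r ∷ T} {i = suc i} = entry-via-row {T = T}

entry-row : T ‼ i ≡ just r → entry T i j ≡ r ‼ j
entry-row {T = T} {i = i} {j = j} eq = trans (entry-via-row {T = T}) (cong (_>>= _‼ j) eq)

entry⇒∈-concat : entry T i j ≡ just x → x ∈ concat T
entry⇒∈-concat {T = r ∷ T} {i = zero}  ex = ∈-++⁺ˡ (‼⇒∈ {xs = r} ex)
entry⇒∈-concat {T = r ∷ T} {i = suc i} ex = ∈-++⁺ʳ r (entry⇒∈-concat {T = T} ex)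

∈-concat⇒entry : x ∈ concat T → ∃₂ λ i j → entry T i j ≡ just x
∈-concat⇒entry {T = T} x∈T =
  let r , x∈r , r∈T = ∈-concat⁻′ T x∈T
      i , eqr = ∈⇒‼ r∈T
      j , eqx = ∈⇒‼ x∈r
  in i , j , trans (entry-row {T = T} eqr) eqx

entry-ext : All (0 <_) (map length T) → All (0 <_) (map length S) →
            (∀ i j → entry T i j ≡ entry S i j) → T ≡ S
entry-ext {T = []}          {S = []}          _ _ _ = refl
entry-ext {T = []}          {S = [] ∷ _}      _ (() ∷ _)
entry-ext {T = []}          {S = (_ ∷ _) ∷ _} _ _ eq with eq 0 0
... | ()
entry-ext {T = [] ∷ _}      {S = _}           (() ∷ _)
entry-ext {T = (_ ∷ _) ∷ _} {S = []}          _ _ eq with eq 0 0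
... | ()
entry-ext {T = r ∷ T} {S = s ∷ S} (_ ∷ posT) (_ ∷ posS) eq =
  cong₂ _∷_ (‼-ext (eq 0)) (entry-ext posT posS (eq ∘ suc))

HasYoungShape : Tableau → Set
HasYoungShape T = Linked _≥_ (map length T)

rows-shorter : HasYoungShape (r ∷ T) → All (λ s → length s ≤ length r) T
rows-shorter {T = []}    _            = []
rows-shorter {T = _ ∷ _} (r≥s ∷ sh) = All.map⁻ (Linked.Linked⇒All (λ a≥b b≥c → ℕ.≤-trans b≥c a≥b) r≥s sh)

entry-beyond : All (λ r → length r ≤ j) T → entry T i j ≡ nothing
entry-beyond                        []          = refl
entry-beyond {T = r ∷ _} {i = zero}  (r≤j ∷ _)   = ≤⇒‼-nothing {xs = r} r≤j
entry-beyond             {i = suc i} (_   ∷ s≤j) = entry-beyond s≤j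

rows-beyond : HasYoungShape (r ∷ T) → length r ≤ j → All (λ s → length s ≤ j) T
rows-beyond {r = r} {T = T} sh r≤j = All.map (λ s≤r → ℕ.≤-trans s≤r r≤j) (rows-shorter {r = r} {T = T} sh)

entry-above : HasYoungShape T → entry T i j ≡ just x → k ≤ i → ∃ λ y → entry T k j ≡ just y
entry-above {T = r ∷ T} {i = zero}              _  ex z≤n = _ , ex
entry-above {T = r ∷ T} {i = suc i} {j = j} sh ex z≤n with j <? length r
... | yes j<r = <⇒‼-just {xs = r} j<r
... | no  j≮r with trans (sym ex) (entry-beyond {T = T} {i = i} (rows-beyond {r = r} sh (ℕ.≮⇒≥ j≮r)))
...   | ()
entry-above {T = r ∷ T} {i = suc i} sh ex (s≤s k≤i) = entry-above (Linked.tail sh) ex k≤i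

column : ℕ → Tableau → List ℕ
column j = mapMaybe (_‼ j)

transpose : Tableau → Tableau
transpose T = applyUpTo (λ j → column j T) (firstPart (map length T))

column-nothing : r ‼ j ≡ nothing → column j (r ∷ T) ≡ column j T
column-nothing {j = j} {T = T} eq = cong (λ m → maybe′ _∷_ id m (column j T)) eq

column-beyond : All (λ r → length r ≤ j) T → column j T ≡ []
column-beyond           []          = refl
column-beyond {T = r ∷ T} (r≤j ∷ s≤j) =
  trans (column-nothing {r = r} {T = T} (≤⇒‼-nothing {xs = r} r≤j)) (column-beyond s≤j)

column-‼ : HasYoungShape T → column j T ‼ i ≡ entry T i j
column-‼ {T = []} _ = refl
column-‼ {T = r ∷ T} {j = j} {i = i} sh with r ‼ j in eq
... | just x = go i
  where
  go : ∀ i → (x ∷ column j T) ‼ i ≡ entry (r ∷ T) i j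
  go zero    = sym eq
  go (suc i) = column-‼ (Linked.tail sh)
... | nothing = begin
  column j T ‼ i    ≡⟨ cong (_‼ i) (column-beyond bounded) ⟩
  nothing           ≡⟨ sym (entry-beyond {T = r ∷ T} {i = i} (‼-nothing⇒≤ {xs = r} eq ∷ bounded)) ⟩
  entry (r ∷ T) i j ∎
  where
  open ≡-Reasoning
  bounded : All (λ s → length s ≤ j) T
  bounded = rows-beyond {r = r} sh (‼-nothing⇒≤ {xs = r} eq)

entry-transpose : HasYoungShape T → entry (transpose T) j i ≡ entry T i j
entry-transpose {T = []} _ = refl
entry-transpose {T = r ∷ T} {j = j} {i = i} sh with j <? length r
... | yes j<r = trans (entry-row {T = transpose (r ∷ T)} (‼-applyUpTo (λ j → column j (r ∷ T)) j<r))
                      (column-‼ {T = r ∷ T} sh)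
... | no  j≮r = begin
  entry (transpose (r ∷ T)) j i     ≡⟨ entry-via-row {T = transpose (r ∷ T)} ⟩
  (transpose (r ∷ T) ‼ j >>= _‼ i) ≡⟨ cong (_>>= _‼ i) (≤⇒‼-nothing {xs = transpose (r ∷ T)} r≤j′) ⟩
  nothing                           ≡⟨ sym (entry-beyond {T = r ∷ T} {i = i} (r≤j ∷ rows-beyond {r = r} sh r≤j)) ⟩
  entry (r ∷ T) i j                 ∎
  where
  open ≡-Reasoning
  r≤j : length r ≤ j
  r≤j = ℕ.≮⇒≥ j≮r
  r≤j′ : length (transpose (r ∷ T)) ≤ j
  r≤j′ = subst (_≤ j) (sym (length-applyUpTo (λ j → column j (r ∷ T)) (length r))) r≤j

length-column : ∀ j T → length (column j T) ≡ length (filter (λ m → suc j ≤? m) (map length T))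
length-column j []      = refl
length-column j (r ∷ T) with r ‼ j in eq
... | just x  = begin
  suc (length (column j T))
    ≡⟨ cong suc (length-column j T) ⟩
  suc (length (filter (λ m → suc j ≤? m) (map length T)))
    ≡⟨ cong length (filter-accept (λ m → suc j ≤? m) (‼-just⇒< {xs = r} eq)) ⟨
  length (filter (λ m → suc j ≤? m) (map length (r ∷ T)))
    ∎
  where open ≡-Reasoning
... | nothing = begin
  length (column j T)
    ≡⟨ length-column j T ⟩
  length (filter (λ m → suc j ≤? m) (map length T))
    ≡⟨ cong length (filter-reject (λ m → suc j ≤? m) (ℕ.≤⇒≯ (‼-nothing⇒≤ {xs = r} eq))) ⟨
  length (filter (λ m → suc j ≤? m) (map length (r ∷ T)))
    ∎
  where open ≡-Reasoning

shape-transpose : ∀ T → map length (transpose T) ≡ conjugate (map length T)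
shape-transpose T = begin
  map length (applyUpTo (λ j → column j T) width)                            ≡⟨ map-applyUpTo _ length width ⟩
  applyUpTo (λ j → length (column j T)) width                                ≡⟨ map-upTo _ width ⟨
  map (λ j → length (column j T)) (upTo width)                               ≡⟨ map-cong (λ j → length-column j T) (upTo width) ⟩
  map (λ j → length (filter (λ m → suc j ≤? m) (map length T))) (upTo width) ≡⟨ map-upTo _ width ⟩
  conjugate (map length T)                                                   ∎
  where
  open ≡-Reasoning
  width : ℕ
  width = firstPart (map length T)

conjugate-decreasing : ∀ μ → Linked _≥_ (conjugate μ)
conjugate-decreasing μ = Linked.applyUpTo⁺₂ _ (firstPart μ) λ j →
  length-filter-mono (λ m → suc (suc j) ≤? m) (λ m → suc j ≤? m) (ℕ.≤-trans (ℕ.n≤1+n _)) μ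

conjugate-positive : ∀ μ → All (0 <_) (conjugate μ)
conjugate-positive []      = []
conjugate-positive (m ∷ μ) = All.applyUpTo⁺₁ _ m λ {j} j<m →
  subst (λ ν → 0 < length ν) (sym (filter-accept (λ m → suc j ≤? m) j<m)) (s≤s z≤n)

transpose-involutive : HasYoungShape T → All (0 <_) (map length T) → transpose (transpose T) ≡ T
transpose-involutive {T = T} sh pos = entry-ext pos′ pos λ i j →
  trans (entry-transpose {T = transpose T} sh′) (entry-transpose {T = T} sh)
  where
  sh′ : HasYoungShape (transpose T)
  sh′ = subst (Linked _≥_) (sym (shape-transpose T)) (conjugate-decreasing (map length T))
  pos′ : All (0 <_) (map length (transpose (transpose T)))
  pos′ = subst (All (0 <_)) (sym (shape-transpose (transpose T)))
               (conjugate-positive (map length (transpose T)))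

-- μ is the shape of its filling by zeros, so shape-transpose reduces this to transpose-involutive.
conjugate-involutive : ∀ {μ} → Linked _≥_ μ → All (0 <_) μ → conjugate (conjugate μ) ≡ μ
conjugate-involutive {μ} dec pos = begin
  conjugate (conjugate μ)                  ≡⟨ cong (conjugate ∘ conjugate) shape-zeros ⟨
  conjugate (conjugate (map length zeros)) ≡⟨ cong conjugate (shape-transpose zeros) ⟨
  conjugate (map length (transpose zeros)) ≡⟨ shape-transpose (transpose zeros) ⟨
  map length (transpose (transpose zeros)) ≡⟨ cong (map length) (transpose-involutive sh pos′) ⟩
  map length zeros                         ≡⟨ shape-zeros ⟩
  μ                                        ∎
  where
  open ≡-Reasoning
  zeros : Tableau
  zeros = map (λ m → replicate m 0) μ
  shape-zeros : map length zeros ≡ μ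
  shape-zeros = trans (sym (map-∘ μ)) (trans (map-cong (λ m → length-replicate m {0}) μ) (map-id μ))
  sh : HasYoungShape zeros
  sh = subst (Linked _≥_) (sym shape-zeros) dec
  pos′ : All (0 <_) (map length zeros)
  pos′ = subst (All (0 <_)) (sym shape-zeros) pos

RowStrict : Tableau → Set
RowStrict T = ∀ {i j j′ x y} → entry T i j ≡ just x → entry T i j′ ≡ just y → j < j′ → x < y

ColumnStrict : Tableau → Set
ColumnStrict T = ∀ {i i′ j x y} → entry T i j ≡ just x → entry T i′ j ≡ just y → i < i′ → x < y

rows⇒rowStrict : All (Linked _<_) T → RowStrict T
rows⇒rowStrict (r< ∷ _)  {i = zero}  = AllPairs-‼ (Linked.Linked⇒AllPairs ℕ.<-trans r<)
rows⇒rowStrict (_  ∷ rs) {i = suc i} = rows⇒rowStrict rs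

rowStrict⇒rows : RowStrict T → All (Linked _<_) T
rowStrict⇒rows {T = []}    _      = []
rowStrict⇒rows {T = r ∷ T} strict =
  Linked-‼ (λ ex ey → strict {i = zero} ex ey (ℕ.n<1+n _)) ∷ rowStrict⇒rows (λ {i} → strict {i = suc i})

adjacent-rows-< : Linked ColsIncr T → entry T i j ≡ just x → entry T (suc i) j ≡ just y → x < y
adjacent-rows-< {T = r ∷ s ∷ _} {i = zero}  (rs ∷ _) ex ey = All-zip-‼ {r = r} {s = s} rs ex ey
adjacent-rows-< {T = _ ∷ _ ∷ _} {i = suc i} (_ ∷ cs) ex ey = adjacent-rows-< cs ex ey
adjacent-rows-< {T = _ ∷ []}    {i = suc i} [-]      () _

columns⇒columnStrict : HasYoungShape T → Linked ColsIncr T → ColumnStrict T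
columns⇒columnStrict {T = T} sh cs {i} {suc i′} ex ey (s≤s i≤i′) with entry-above {T = T} sh ey (ℕ.n≤1+n i′)
... | z , ez with ℕ.m≤n⇒m<n∨m≡n i≤i′
...   | inj₁ i<i′ = ℕ.<-trans (columns⇒columnStrict sh cs ex ez i<i′) (adjacent-rows-< cs ez ey)
...   | inj₂ refl = subst (_< _) (just-injective (trans (sym ez) ex)) (adjacent-rows-< cs ez ey)

columnStrict⇒columns : ColumnStrict T → Linked ColsIncr T
columnStrict⇒columns {T = T} strict = Linked-‼ λ {i} T‼i T‼1+i → ‼-All-zip λ ex ey →
  strict (trans (entry-row {T = T} T‼i) ex) (trans (entry-row {T = T} T‼1+i) ey) (ℕ.n<1+n i)

rowMonotone : RowStrict T → entry T i j ≡ just x → entry T i j′ ≡ just y → j ≤ j′ → x ≤ y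
rowMonotone strict ex ey j≤j′ with ℕ.m≤n⇒m<n∨m≡n j≤j′
... | inj₁ j<j′ = ℕ.<⇒≤ (strict ex ey j<j′)
... | inj₂ refl = ℕ.≤-reflexive (just-injective (trans (sym ex) ey))

columnMonotone : ColumnStrict T → entry T i j ≡ just x → entry T i′ j ≡ just y → i ≤ i′ → x ≤ y
columnMonotone strict ex ey i≤i′ with ℕ.m≤n⇒m<n∨m≡n i≤i′
... | inj₁ i<i′ = ℕ.<⇒≤ (strict ex ey i<i′)
... | inj₂ refl = ℕ.≤-reflexive (just-injective (trans (sym ex) ey))

module _ (sh : HasYoungShape T) where

  entry-transpose⁺ : entry T i j ≡ just x → entry (transpose T) j i ≡ just x
  entry-transpose⁺ = trans (entry-transpose {T = T} sh)

  entry-transpose⁻ : entry (transpose T) j i ≡ just x → entry T i j ≡ just x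
  entry-transpose⁻ = trans (sym (entry-transpose {T = T} sh))

  transpose-rowStrict : ColumnStrict T → RowStrict (transpose T)
  transpose-rowStrict strict ex ey = strict (entry-transpose⁻ ex) (entry-transpose⁻ ey)

  transpose-columnStrict : RowStrict T → ColumnStrict (transpose T)
  transpose-columnStrict strict ex ey = strict (entry-transpose⁻ ex) (entry-transpose⁻ ey)

  ∈-concat-transpose⁺ : x ∈ concat T → x ∈ concat (transpose T)
  ∈-concat-transpose⁺ x∈T = let i , j , ex = ∈-concat⇒entry {T = T} x∈T in
    entry⇒∈-concat {T = transpose T} (entry-transpose⁺ ex)

  ∈-concat-transpose⁻ : x ∈ concat (transpose T) → x ∈ concat T
  ∈-concat-transpose⁻ x∈Tᵗ = let j , i , ex = ∈-concat⇒entry {T = transpose T} x∈Tᵗ in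
    entry⇒∈-concat {T = T} (entry-transpose⁻ ex)

  transpose-isStandard : ∀ {w} → IsStandard w T → IsStandard w (transpose T)
  transpose-isStandard (rows , cols , covered) =
      rowStrict⇒rows (transpose-rowStrict (columns⇒columnStrict sh cols))
    , columnStrict⇒columns (transpose-columnStrict (rows⇒rowStrict rows))
    , All.map ∈-concat-transpose⁺ covered

∈-listsOf⁻ : ∀ l {v : List ℕ} → v ∈ listsOf l xs → length v ≡ l × All (_∈ xs) v
∈-listsOf⁻ zero    (here refl) = refl , []
∈-listsOf⁻ {xs = xs} (suc l) v∈
  with x , u , x∈xs , u∈ , refl ← ∈-cartesianProductWith⁻ List._∷_ xs (listsOf l xs)
                                     (subst (_ ∈_) (concatMap-∷ xs _) v∈)
  = let length-u , u⊆xs = ∈-listsOf⁻ l u∈ in cong suc length-u , x∈xs ∷ u⊆xs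

∈-listsOf⁺ : {v : List ℕ} → All (_∈ xs) v → v ∈ listsOf (length v) xs
∈-listsOf⁺              []           = here refl
∈-listsOf⁺ {xs = xs} (x∈xs ∷ v⊆xs) =
  subst (_ ∈_) (sym (concatMap-∷ xs _)) (∈-cartesianProductWith⁺ List._∷_ x∈xs (∈-listsOf⁺ v⊆xs))

listsOf-unique : ∀ l → Unique xs → Unique (listsOf l xs)
listsOf-unique zero    _ = [] ∷ []
listsOf-unique {xs = xs} (suc l) u = subst Unique (sym (concatMap-∷ xs _))
  (Unique.cartesianProductWith⁺ List._∷_ ∷-injective u (listsOf-unique l u))

∈-fillings⁻ : ∀ w μ → T ∈ fillings w μ → map length T ≡ μ × All (All (_∈ oneTo w)) T
∈-fillings⁻ w []      (here refl) = refl , []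
∈-fillings⁻ w (l ∷ μ) T∈
  with r , T , r∈ , T∈ , refl ← ∈-cartesianProductWith⁻ List._∷_ (listsOf l (oneTo w)) (fillings w μ)
                                   (subst (_ ∈_) (concatMap-∷ (listsOf l (oneTo w)) (fillings w μ)) T∈)
  = let length-r , r⊆ = ∈-listsOf⁻ l r∈; shape-T , T⊆ = ∈-fillings⁻ w μ T∈
    in cong₂ _∷_ length-r shape-T , r⊆ ∷ T⊆

∈-fillings⁺ : ∀ {w} → All (All (_∈ oneTo w)) T → T ∈ fillings w (map length T)
∈-fillings⁺         []         = here refl
∈-fillings⁺ {T = r ∷ T} {w = w} (r⊆ ∷ T⊆) =
  subst (_ ∈_) (sym (concatMap-∷ (listsOf (length r) (oneTo w)) (fillings w (map length T))))
        (∈-cartesianProductWith⁺ List._∷_ (∈-listsOf⁺ r⊆) (∈-fillings⁺ T⊆))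

fillings-unique : ∀ w μ → Unique (fillings w μ)
fillings-unique w []      = [] ∷ []
fillings-unique w (l ∷ μ) = subst Unique (sym (concatMap-∷ (listsOf l (oneTo w)) _))
  (Unique.cartesianProductWith⁺ List._∷_ ∷-injective (listsOf-unique l (oneTo-unique w)) (fillings-unique w μ))

∈-SYT⁻ : ∀ w μ → T ∈ SYT w μ → map length T ≡ μ × All (All (_∈ oneTo w)) T × IsStandard w T
∈-SYT⁻ w μ T∈ =
  let T∈fillings , standard = ∈-filter⁻ (isStandard? w) {xs = fillings w μ} T∈
      shape , range = ∈-fillings⁻ w μ T∈fillings
  in shape , range , standard

∈-SYT⁺ : ∀ {w} → All (All (_∈ oneTo w)) T → IsStandard w T → T ∈ SYT w (map length T)
∈-SYT⁺ {w = w} range standard = ∈-filter⁺ (isStandard? w) (∈-fillings⁺ range) standard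

SYT-unique : ∀ w μ → Unique (SYT w μ)
SYT-unique w μ = Unique.filter⁺ (isStandard? w) (fillings-unique w μ)

SYT-hasYoungShape : ∀ {w μ} → Linked _≥_ μ → T ∈ SYT w μ → HasYoungShape T
SYT-hasYoungShape {w = w} {μ} dec T∈ = subst (Linked _≥_) (sym (proj₁ (∈-SYT⁻ w μ T∈))) dec

transpose-∈-SYT : ∀ {w μ} → Linked _≥_ μ → T ∈ SYT w μ → transpose T ∈ SYT w (conjugate μ)
transpose-∈-SYT {T = T} {w} {μ} dec T∈ =
  let shape , range , standard = ∈-SYT⁻ w μ T∈
      sh = SYT-hasYoungShape dec T∈
      rangeᵗ = All.concat⁻ (All.tabulate (All.lookup (All.concat⁺ range) ∘ ∈-concat-transpose⁻ {T = T} sh))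
  in subst (λ ν → transpose T ∈ SYT w ν) (trans (shape-transpose T) (cong conjugate shape))
           (∈-SYT⁺ rangeᵗ (transpose-isStandard sh standard))

transpose-involutive-SYT : ∀ {w μ} → Linked _≥_ μ → All (0 <_) μ → T ∈ SYT w μ → transpose (transpose T) ≡ T
transpose-involutive-SYT {w = w} {μ} dec pos T∈ =
  transpose-involutive (SYT-hasYoungShape dec T∈) (subst (All (0 <_)) (sym (proj₁ (∈-SYT⁻ w μ T∈))) pos)

map-transpose-SYT : ∀ {w μ} → IsPartition w μ → map transpose (SYT w μ) ↭ SYT w (conjugate μ)
map-transpose-SYT {w} {μ} (dec , pos , _) =
  ∼bag⇒↭ (unique∧set⇒bag unique (SYT-unique w (conjugate μ)) (mk⇔ to from))
  where
  unique : Unique (map transpose (SYT w μ))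
  unique = Unique-map-retraction {g = transpose} (transpose-involutive-SYT dec pos) (SYT-unique w μ)
  to : ∀ {S} → S ∈ map transpose (SYT w μ) → S ∈ SYT w (conjugate μ)
  to S∈ with T , T∈ , refl ← ∈-map⁻ transpose S∈ = transpose-∈-SYT dec T∈
  from : ∀ {S} → S ∈ SYT w (conjugate μ) → S ∈ map transpose (SYT w μ)
  from {S} S∈ = subst (_∈ map transpose (SYT w μ))
    (transpose-involutive-SYT (conjugate-decreasing μ) (conjugate-positive μ) S∈)
    (∈-map⁺ transpose (subst (λ ν → transpose S ∈ SYT w ν) (conjugate-involutive dec pos)
                             (transpose-∈-SYT (conjugate-decreasing μ) S∈)))

EntriesDistinct : Tableau → Set
EntriesDistinct T = ∀ {i j i′ j′ x} → entry T i j ≡ just x → entry T i′ j′ ≡ just x → i ≡ i′ × j ≡ j′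

Unique⇒entriesDistinct : Unique (concat T) → EntriesDistinct T
Unique⇒entriesDistinct {T = r ∷ T} u {zero} {_} {zero} ex ex′ =
  refl , Unique-‼-injective (proj₁ (Unique-++⁻ {xs = r} u)) ex ex′
Unique⇒entriesDistinct {T = r ∷ T} u {zero} {_} {suc i′} ex ex′ =
  ⊥-elim (Unique-++-disjoint {xs = r} u (‼⇒∈ {xs = r} ex) (entry⇒∈-concat {T = T} ex′))
Unique⇒entriesDistinct {T = r ∷ T} u {suc i} {_} {zero} ex ex′ =
  ⊥-elim (Unique-++-disjoint {xs = r} u (‼⇒∈ {xs = r} ex′) (entry⇒∈-concat {T = T} ex))
Unique⇒entriesDistinct {T = r ∷ T} u {suc i} {_} {suc i′} ex ex′ =
  let i≡i′ , j≡j′ = Unique⇒entriesDistinct {T = T} (proj₂ (Unique-++⁻ {xs = r} u)) ex ex′ in cong suc i≡i′ , j≡j′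

transpose-entriesDistinct : HasYoungShape T → EntriesDistinct T → EntriesDistinct (transpose T)
transpose-entriesDistinct {T = T} sh distinct ex ex′ =
  let j≡j′ , i≡i′ = distinct (entry-transpose⁻ {T = T} sh ex) (entry-transpose⁻ {T = T} sh ex′) in i≡i′ , j≡j′

-- IsStandard only asks that each of 1, …, w occurs; since there are w cells, no entry repeats.
-- This is what makes rowOf (the first row containing x) the row of x.
SYT-entries-unique : ∀ {w μ} → IsPartition w μ → T ∈ SYT w μ → Unique (concat T)
SYT-entries-unique {T = T} {w = w} {μ = μ} (_ , _ , size) T∈ =
  let shape , _ , _ , _ , covered = ∈-SYT⁻ w μ T∈ in
  pigeonhole ℕ._≟_ (oneTo-unique w) covered (ℕ.≤-reflexive (begin
    length (concat T)    ≡⟨ length-concat T ⟩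
    sum (map length T)   ≡⟨ cong sum shape ⟩
    sum μ                ≡⟨ size ⟩
    w                    ≡⟨ length-applyUpTo suc w ⟨
    length (oneTo w)     ∎))
  where open ≡-Reasoning

rowOf-entry : entry T i j ≡ just x → ∃ λ j′ → entry T (rowOf T x) j′ ≡ just x
rowOf-entry {T = r ∷ T} {x = x} ex with x ∈? r
... | yes x∈r = ∈⇒‼ x∈r
rowOf-entry {T = r ∷ T} {i = zero}  ex | no x∉r = ⊥-elim (x∉r (‼⇒∈ {xs = r} ex))
rowOf-entry {T = r ∷ T} {i = suc i} ex | no x∉r = rowOf-entry {T = T} ex

rowOf-distinct : EntriesDistinct T → entry T i j ≡ just x → rowOf T x ≡ i
rowOf-distinct {T = T} distinct ex = let _ , ex′ = rowOf-entry {T = T} ex in proj₁ (distinct ex′ ex)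

module _ (sh : HasYoungShape T) (rows : RowStrict T) (columns : ColumnStrict T)
         (ex : entry T i j ≡ just x) (ey : entry T i′ j′ ≡ just (suc x)) where

  successor-not-below-and-right : ¬ (i < i′ × j < j′)
  successor-not-below-and-right (i<i′ , j<j′) =
    -- the cell (i, j′) would hold a value strictly between x and x + 1
    let z , ez = entry-above {T = T} sh ey (ℕ.<⇒≤ i<i′)
    in ℕ.<-irrefl refl (ℕ.<-≤-trans (rows ex ez j<j′) (ℕ.≤-pred (columns ez ey i<i′)))

  successor-below-or-right : i < i′ ⊎ j < j′
  successor-below-or-right with i <? i′ | j <? j′
  ... | yes i<i′ | _        = inj₁ i<i′
  ... | no  _    | yes j<j′ = inj₂ j<j′
  ... | no  i≮i′ | no  j≮j′ =
    -- the cell (i′, j) would hold a value at least x + 1 and at most x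
    let z , ez = entry-above {T = T} sh ex (ℕ.≮⇒≥ i≮i′)
    in ⊥-elim (ℕ.<-irrefl refl (ℕ.≤-trans (rowMonotone {T = T} rows ey ez (ℕ.≮⇒≥ j≮j′))
                                           (columnMonotone {T = T} columns ez ex (ℕ.≮⇒≥ i≮i′))))

  descent-transpose-cells : EntriesDistinct T → does (rowOf (transpose T) x <? rowOf (transpose T) (suc x))
                                                ≡ not (does (rowOf T x <? rowOf T (suc x)))
  descent-transpose-cells distinct
    rewrite rowOf-distinct {T = T} distinct ex
          | rowOf-distinct {T = T} distinct ey
          | rowOf-distinct {T = transpose T} (transpose-entriesDistinct sh distinct) (entry-transpose⁺ sh ex)
          | rowOf-distinct {T = transpose T} (transpose-entriesDistinct sh distinct) (entry-transpose⁺ sh ey)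
    = does-xor (i <? i′) (j <? j′) successor-not-below-and-right successor-below-or-right

descent-transpose : ∀ {μ} → IsPartition (suc n) μ → T ∈ SYT (suc n) μ → x ∈ oneTo n →
  does (rowOf (transpose T) x <? rowOf (transpose T) (suc x)) ≡ not (does (rowOf T x <? rowOf T (suc x)))
descent-transpose {n = n} {T = T} {μ = μ} partition@(dec , _) T∈ x∈
  with m , m<n , refl ← ∈-applyUpTo⁻ suc x∈ =
  let _ , _ , rows , columns , covered = ∈-SYT⁻ (suc n) μ T∈
      sh = SYT-hasYoungShape dec T∈
      i  , j  , ex = ∈-concat⇒entry {T = T} (All.lookup covered (∈-applyUpTo⁺ suc (ℕ.m<n⇒m<1+n m<n)))
      i′ , j′ , ey = ∈-concat⇒entry {T = T} (All.lookup covered (∈-applyUpTo⁺ suc (s≤s m<n)))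
  in descent-transpose-cells sh (rows⇒rowStrict rows) (columns⇒columnStrict sh columns) ex ey
       (Unique⇒entriesDistinct {T = T} (SYT-entries-unique partition T∈))

descents-transpose-↭ : ∀ {μ} → IsPartition (suc n) μ → T ∈ SYT (suc n) μ →
                       descents (suc n) T ++ descents (suc n) (transpose T) ↭ oneTo n
descents-transpose-↭ {T = T} partition T∈ =
  filter-complement-↭ (λ k → rowOf T k <? rowOf T (suc k))
                      (λ k → rowOf (transpose T) k <? rowOf (transpose T) (suc k))
                      (descent-transpose partition T∈)

des-transpose : ∀ {μ} → IsPartition (suc n) μ → T ∈ SYT (suc n) μ → des (suc n) T ℕ.+ des (suc n) (transpose T) ≡ n
des-transpose {n = n} {T = T} partition T∈ = begin
  des (suc n) T ℕ.+ des (suc n) (transpose T)                 ≡⟨ length-++ (descents (suc n) T) ⟨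
  length (descents (suc n) T ++ descents (suc n) (transpose T)) ≡⟨ ↭-length (descents-transpose-↭ partition T∈) ⟩
  length (oneTo n)                                            ≡⟨ length-applyUpTo suc n ⟩
  n                                                           ∎
  where open ≡-Reasoning

maj-transpose : ∀ {μ} → IsPartition (suc n) μ → T ∈ SYT (suc n) μ →
                maj (suc n) T ℕ.+ maj (suc n) (transpose T) ≡ sum (oneTo n)
maj-transpose {n = n} {T = T} partition T∈ =
  trans (sym (sum-++ (descents (suc n) T) _)) (sum-↭ (descents-transpose-↭ partition T∈))

ℚ-ring : ACR.AlmostCommutativeRing _ _
ℚ-ring = ACR.fromCommutativeRing ℚ.+-*-commutativeRing (λ _ → nothing)

^ℕ≡^ : ∀ x n → x ^ℕ n ≡ x ^ n
^ℕ≡^ x zero    = refl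
^ℕ≡^ x (suc n) = cong (x *_) (^ℕ≡^ x n)

^ℕ-homo-* : ∀ x m n → x ^ℕ (m ℕ.+ n) ≡ x ^ℕ m * x ^ℕ n
^ℕ-homo-* x m n rewrite ^ℕ≡^ x (m ℕ.+ n) | ^ℕ≡^ x m | ^ℕ≡^ x n = ^-homo-* x m n

^ℕ-assocʳ : ∀ x m n → (x ^ℕ m) ^ℕ n ≡ x ^ℕ (m ℕ.* n)
^ℕ-assocʳ x m n rewrite ^ℕ≡^ (x ^ℕ m) n | ^ℕ≡^ x m | ^ℕ≡^ x (m ℕ.* n) = ^-assocʳ x m n

^ℕ-distrib-* : ∀ x y n → (x * y) ^ℕ n ≡ x ^ℕ n * y ^ℕ n
^ℕ-distrib-* x y n rewrite ^ℕ≡^ (x * y) n | ^ℕ≡^ x n | ^ℕ≡^ y n = ^-distrib-* x y n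

1^ℕ : ∀ n → 1ℚ ^ℕ n ≡ 1ℚ
1^ℕ zero    = refl
1^ℕ (suc n) = trans (ℚ.*-identityˡ _) (1^ℕ n)

module _ (x : ℚ) .{{_ : NonZero x}} where

  ^ℕ-inverseʳ : ∀ n → x ^ℕ n * (1/ x) ^ℕ n ≡ 1ℚ
  ^ℕ-inverseʳ n = begin
    x ^ℕ n * (1/ x) ^ℕ n ≡⟨ ^ℕ-distrib-* x (1/ x) n ⟨
    (x * 1/ x) ^ℕ n      ≡⟨ cong (_^ℕ n) (ℚ.*-inverseʳ x) ⟩
    1ℚ ^ℕ n              ≡⟨ 1^ℕ n ⟩
    1ℚ                   ∎
    where open ≡-Reasoning

  ^ℕ-*-1/^ℕ-shift : ∀ k a b → x ^ℕ (k ℕ.+ a) * (1/ x) ^ℕ (k ℕ.+ b) ≡ x ^ℕ a * (1/ x) ^ℕ b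
  ^ℕ-*-1/^ℕ-shift zero    a b = refl
  ^ℕ-*-1/^ℕ-shift (suc k) a b = begin
    x * x ^ℕ (k ℕ.+ a) * (1/ x * (1/ x) ^ℕ (k ℕ.+ b))  ≡⟨ regroup x (1/ x) (x ^ℕ (k ℕ.+ a)) ((1/ x) ^ℕ (k ℕ.+ b)) ⟩
    x * 1/ x * (x ^ℕ (k ℕ.+ a) * (1/ x) ^ℕ (k ℕ.+ b)) ≡⟨ cong₂ _*_ (ℚ.*-inverseʳ x) (^ℕ-*-1/^ℕ-shift k a b) ⟩
    1ℚ * (x ^ℕ a * (1/ x) ^ℕ b)                        ≡⟨ ℚ.*-identityˡ _ ⟩
    x ^ℕ a * (1/ x) ^ℕ b                               ∎
    where
    open ≡-Reasoning
    regroup : ∀ u v s t → u * s * (v * t) ≡ u * v * (s * t)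
    regroup = solve-∀ ℚ-ring

  ^ℕ-*-1/^ℕ-cong : ∀ a b c e → a ℕ.+ e ≡ c ℕ.+ b → x ^ℕ a * (1/ x) ^ℕ b ≡ x ^ℕ c * (1/ x) ^ℕ e
  ^ℕ-*-1/^ℕ-cong a b c e a+e≡c+b = begin
    x ^ℕ a * (1/ x) ^ℕ b                 ≡⟨ ^ℕ-*-1/^ℕ-shift e a b ⟨
    x ^ℕ (e ℕ.+ a) * (1/ x) ^ℕ (e ℕ.+ b) ≡⟨ cong₂ (λ m n → x ^ℕ m * (1/ x) ^ℕ n) e+a≡b+c (ℕ.+-comm e b) ⟩
    x ^ℕ (b ℕ.+ c) * (1/ x) ^ℕ (b ℕ.+ e) ≡⟨ ^ℕ-*-1/^ℕ-shift b c e ⟩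
    x ^ℕ c * (1/ x) ^ℕ e                 ∎
    where
    open ≡-Reasoning
    e+a≡b+c : e ℕ.+ a ≡ b ℕ.+ c
    e+a≡b+c = trans (ℕ.+-comm e a) (trans a+e≡c+b (ℕ.+-comm c b))

  ^ℤ-neg : ∀ k → x ^ℤ (ℤ.- (+ k)) ≡ (1/ x) ^ℕ k
  ^ℤ-neg zero    = refl
  ^ℤ-neg (suc k) = refl

  ^ℤ-⊖ : ∀ a b → x ^ℤ (a ⊖ b) ≡ x ^ℕ a * (1/ x) ^ℕ b
  ^ℤ-⊖ a       zero    = sym (ℚ.*-identityʳ _)
  ^ℤ-⊖ zero    (suc b) = sym (ℚ.*-identityˡ _)
  ^ℤ-⊖ (suc a) (suc b) = begin
    x ^ℤ (suc a ⊖ suc b)              ≡⟨ cong (x ^ℤ_) (ℤ.[1+m]⊖[1+n]≡m⊖n a b) ⟩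
    x ^ℤ (a ⊖ b)                      ≡⟨ ^ℤ-⊖ a b ⟩
    x ^ℕ a * (1/ x) ^ℕ b              ≡⟨ ^ℕ-*-1/^ℕ-shift 1 a b ⟨
    x ^ℕ suc a * (1/ x) ^ℕ suc b      ∎
    where open ≡-Reasoning

  ^ℤ-inverseˡ : ∀ e → _^ℤ_ (1/ x) {{inv-nonZero x}} e * x ^ℤ e ≡ 1ℚ
  ^ℤ-inverseˡ (+ n)      = trans (ℚ.*-comm ((1/ x) ^ℕ n) (x ^ℕ n)) (^ℕ-inverseʳ n)
  ^ℤ-inverseˡ (-[1+ n ]) = trans (cong (λ y → y ^ℕ suc n * (1/ x) ^ℕ suc n) (ℚ.1/-involutive x)) (^ℕ-inverseʳ (suc n))

sumℚ-↭ : {xs ys : List ℚ} → xs ↭ ys → sumℚ xs ≡ sumℚ ys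
sumℚ-↭ xs↭ys = foldr-commMonoid (setoid ℚ) ℚ.+-0-isCommutativeMonoid (↭⇒↭ₛ xs↭ys)

sumℚ-map-*ˡ : ∀ c (f : A → ℚ) xs → c * sumℚ (map f xs) ≡ sumℚ (map (λ x → c * f x) xs)
sumℚ-map-*ˡ c f []       = ℚ.*-zeroʳ c
sumℚ-map-*ˡ c f (x ∷ xs) = trans (ℚ.*-distribˡ-+ c (f x) _) (cong (λ s → c * f x + s) (sumℚ-map-*ˡ c f xs))

prodℚ-map-* : ∀ (f g : A → ℚ) xs → prodℚ (map (λ x → f x * g x) xs) ≡ prodℚ (map f xs) * prodℚ (map g xs)
prodℚ-map-* f g []       = refl
prodℚ-map-* f g (x ∷ xs) = trans (cong (f x * g x *_) (prodℚ-map-* f g xs)) (interchange (f x) (g x) _ _)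
  where
  interchange : ∀ a b c d → a * b * (c * d) ≡ a * c * (b * d)
  interchange = solve-∀ ℚ-ring

prodℚ-map-const : ∀ c (xs : List A) → prodℚ (map (λ _ → c) xs) ≡ c ^ℕ length xs
prodℚ-map-const c []       = refl
prodℚ-map-const c (_ ∷ xs) = cong (c *_) (prodℚ-map-const c xs)

prodℚ-map-^ℕ : ∀ c (f : A → ℕ) xs → prodℚ (map (λ x → c ^ℕ f x) xs) ≡ c ^ℕ sum (map f xs)
prodℚ-map-^ℕ c f []       = refl
prodℚ-map-^ℕ c f (x ∷ xs) = trans (cong (c ^ℕ f x *_) (prodℚ-map-^ℕ c f xs)) (sym (^ℕ-homo-* c (f x) _))

÷-unique : ∀ {p r d} .{{_ : NonZero d}} → p ≡ r * d → p ÷ d ≡ r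
÷-unique {r = r} {d} refl = begin
  r * d * 1/ d   ≡⟨ ℚ.*-assoc r d (1/ d) ⟩
  r * (d * 1/ d) ≡⟨ cong (r *_) (ℚ.*-inverseʳ d) ⟩
  r * 1ℚ         ≡⟨ ℚ.*-identityʳ r ⟩
  r              ∎
  where open ≡-Reasoning

÷-rescale : ∀ {p₁ d₁ p₂ d₂} (a b c : ℚ) .{{_ : NonZero d₁}} .{{_ : NonZero d₂}} →
            p₂ ≡ a * p₁ → d₁ ≡ b * d₂ → c * a * b ≡ 1ℚ → p₁ ÷ d₁ ≡ c * (p₂ ÷ d₂)
÷-rescale {p₁} {d₂ = d₂} a b c refl refl c*a*b≡1 = ÷-unique (sym (begin
  c * (a * p₁ * 1/ d₂) * (b * d₂) ≡⟨ regroup c a b p₁ d₂ (1/ d₂) ⟩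
  c * a * b * p₁ * (d₂ * 1/ d₂)   ≡⟨ cong₂ (λ u v → u * p₁ * v) c*a*b≡1 (ℚ.*-inverseʳ d₂) ⟩
  1ℚ * p₁ * 1ℚ                    ≡⟨ ℚ.*-identityʳ _ ⟩
  1ℚ * p₁                         ≡⟨ ℚ.*-identityˡ p₁ ⟩
  p₁                              ∎))
  where
  open ≡-Reasoning
  regroup : ∀ c a b p d e → c * (a * p * e) * (b * d) ≡ c * a * b * p * (d * e)
  regroup = solve-∀ ℚ-ring

factor-inversion : ∀ u v t t′ → t′ * t ≡ 1ℚ → v * u ≡ 1ℚ → 1ℚ - t′ * u ≡ (- u) * (t′ * (1ℚ - t * v))
factor-inversion u v t t′ t′*t≡1 v*u≡1 = begin
  1ℚ - t′ * u                   ≡⟨ cong (_- t′ * u) (ℚ.*-identityˡ 1ℚ) ⟨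
  1ℚ * 1ℚ - t′ * u              ≡⟨ cong₂ (λ a b → a * b - t′ * u) t′*t≡1 v*u≡1 ⟨
  t′ * t * (v * u) - t′ * u     ≡⟨ expand u v t t′ ⟩
  (- u) * (t′ * (1ℚ - t * v))   ∎
  where
  open ≡-Reasoning
  expand : ∀ u v t t′ → t′ * t * (v * u) - t′ * u ≡ (- u) * (t′ * (1ℚ - t * v))
  expand = solve-∀ ℚ-ring

QEhrTerm : ℕ → (z q : ℚ) .{{_ : NonZero q}} → Tableau → ℚ
QEhrTerm w z q T = q ^ℤ (ℤ.- (+ (2 ℕ.* maj w T))) * ((z * q ^ℕ w) ^ℕ des w T)

module _ (z q : ℚ) .{{_ : NonZero z}} .{{_ : NonZero q}} where

  private instance
    1/q-nonZero : NonZero (1/ q)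
    1/q-nonZero = inv-nonZero q

  QEhrTerm-inversion : ∀ {n d d′ m m′} → d ℕ.+ d′ ≡ n → 2 ℕ.* (m ℕ.+ m′) ≡ n ℕ.* suc n →
    z ^ℕ n * ((1/ q) ^ℤ (ℤ.- (+ (2 ℕ.* m))) * ((1/ z * (1/ q) ^ℕ suc n) ^ℕ d))
      ≡ q ^ℤ (ℤ.- (+ (2 ℕ.* m′))) * ((z * q ^ℕ suc n) ^ℕ d′)
  QEhrTerm-inversion {n} {d} {d′} {m} {m′} d+d′≡n 2[m+m′]≡n[n+1] = begin
    z ^ℕ n * ((1/ q) ^ℤ (ℤ.- (+ (2 ℕ.* m))) * ((1/ z * (1/ q) ^ℕ w) ^ℕ d))
      ≡⟨ cong₂ (λ a b → z ^ℕ n * (a * b)) q-part z-part ⟩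
    z ^ℕ n * (q ^ℕ (2 ℕ.* m) * ((1/ z) ^ℕ d * (1/ q) ^ℕ (w ℕ.* d)))
      ≡⟨ regroup (z ^ℕ n) (q ^ℕ (2 ℕ.* m)) ((1/ z) ^ℕ d) ((1/ q) ^ℕ (w ℕ.* d)) ⟩
    z ^ℕ n * (1/ z) ^ℕ d * (q ^ℕ (2 ℕ.* m) * (1/ q) ^ℕ (w ℕ.* d))
      ≡⟨ cong₂ _*_ z-powers q-powers ⟩
    z ^ℕ d′ * 1ℚ * (q ^ℕ (w ℕ.* d′) * (1/ q) ^ℕ (2 ℕ.* m′))
      ≡⟨ regroup′ (z ^ℕ d′) (q ^ℕ (w ℕ.* d′)) ((1/ q) ^ℕ (2 ℕ.* m′)) ⟩
    (1/ q) ^ℕ (2 ℕ.* m′) * (z ^ℕ d′ * q ^ℕ (w ℕ.* d′))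
      ≡⟨ cong₂ (λ a b → a * (z ^ℕ d′ * b)) (^ℤ-neg q (2 ℕ.* m′)) (^ℕ-assocʳ q w d′) ⟨
    q ^ℤ (ℤ.- (+ (2 ℕ.* m′))) * (z ^ℕ d′ * (q ^ℕ w) ^ℕ d′)
      ≡⟨ cong (q ^ℤ (ℤ.- (+ (2 ℕ.* m′))) *_) (^ℕ-distrib-* z (q ^ℕ w) d′) ⟨
    q ^ℤ (ℤ.- (+ (2 ℕ.* m′))) * ((z * q ^ℕ w) ^ℕ d′)
      ∎
    where
    open ≡-Reasoning
    w : ℕ
    w = suc n
    q-part : (1/ q) ^ℤ (ℤ.- (+ (2 ℕ.* m))) ≡ q ^ℕ (2 ℕ.* m)
    q-part = trans (^ℤ-neg (1/ q) (2 ℕ.* m)) (cong (_^ℕ (2 ℕ.* m)) (ℚ.1/-involutive q))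
    z-part : (1/ z * (1/ q) ^ℕ w) ^ℕ d ≡ (1/ z) ^ℕ d * (1/ q) ^ℕ (w ℕ.* d)
    z-part = trans (^ℕ-distrib-* (1/ z) ((1/ q) ^ℕ w) d) (cong ((1/ z) ^ℕ d *_) (^ℕ-assocʳ (1/ q) w d))
    z-powers : z ^ℕ n * (1/ z) ^ℕ d ≡ z ^ℕ d′ * 1ℚ
    z-powers = ^ℕ-*-1/^ℕ-cong z n d d′ 0 (trans (ℕ.+-identityʳ n) (trans (sym d+d′≡n) (ℕ.+-comm d d′)))
    q-powers : q ^ℕ (2 ℕ.* m) * (1/ q) ^ℕ (w ℕ.* d) ≡ q ^ℕ (w ℕ.* d′) * (1/ q) ^ℕ (2 ℕ.* m′)
    q-powers = ^ℕ-*-1/^ℕ-cong q (2 ℕ.* m) (w ℕ.* d) (w ℕ.* d′) (2 ℕ.* m′) (begin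
      2 ℕ.* m ℕ.+ 2 ℕ.* m′  ≡⟨ ℕ.*-distribˡ-+ 2 m m′ ⟨
      2 ℕ.* (m ℕ.+ m′)      ≡⟨ 2[m+m′]≡n[n+1] ⟩
      n ℕ.* w               ≡⟨ ℕ.*-comm n w ⟩
      w ℕ.* n               ≡⟨ cong (w ℕ.*_) (trans (sym d+d′≡n) (ℕ.+-comm d d′)) ⟩
      w ℕ.* (d′ ℕ.+ d)      ≡⟨ ℕ.*-distribˡ-+ w d′ d ⟩
      w ℕ.* d′ ℕ.+ w ℕ.* d  ∎)
    regroup : ∀ a b c e → a * (b * (c * e)) ≡ a * c * (b * e)
    regroup = solve-∀ ℚ-ring
    regroup′ : ∀ a b c → a * 1ℚ * (b * c) ≡ c * (a * b)
    regroup′ = solve-∀ ℚ-ring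

  QEhrNum-inversion : ∀ {n μ} → IsPartition (suc n) μ →
                      z ^ℕ n * QEhrNum (suc n) μ (1/ z) (1/ q) ≡ QEhrNum (suc n) (conjugate μ) z q
  QEhrNum-inversion {n} {μ} partition = begin
    z ^ℕ n * sumℚ (map (QEhrTerm w (1/ z) (1/ q)) (SYT w μ))
      ≡⟨ sumℚ-map-*ˡ (z ^ℕ n) _ (SYT w μ) ⟩
    sumℚ (map (λ T → z ^ℕ n * QEhrTerm w (1/ z) (1/ q) T) (SYT w μ))
      ≡⟨ cong sumℚ (map-cong-local (All.tabulate termwise)) ⟩
    sumℚ (map (QEhrTerm w z q ∘ transpose) (SYT w μ))
      ≡⟨ cong sumℚ (map-∘ (SYT w μ)) ⟩
    sumℚ (map (QEhrTerm w z q) (map transpose (SYT w μ)))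
      ≡⟨ sumℚ-↭ (↭-map⁺ (QEhrTerm w z q) (map-transpose-SYT partition)) ⟩
    sumℚ (map (QEhrTerm w z q) (SYT w (conjugate μ)))
      ∎
    where
    open ≡-Reasoning
    w : ℕ
    w = suc n
    termwise : ∀ {T} → T ∈ SYT w μ → z ^ℕ n * QEhrTerm w (1/ z) (1/ q) T ≡ QEhrTerm w z q (transpose T)
    termwise {T} T∈ =
      QEhrTerm-inversion {d = des w T} {d′ = des w (transpose T)} {m = maj w T} {m′ = maj w (transpose T)}
        (des-transpose {T = T} partition T∈)
        (trans (cong (2 ℕ.*_) (maj-transpose {T = T} partition T∈)) (2*sum-oneTo n))

  prodℚ-1/q^ℤ-shifts : ∀ w → prodℚ (map (λ i → (1/ q) ^ℤ ((+ w) ℤ.- (+ (2 ℕ.* i)))) (upTo (suc w))) ≡ 1ℚ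
  prodℚ-1/q^ℤ-shifts w = begin
    prodℚ (map (λ i → (1/ q) ^ℤ ((+ w) ℤ.- (+ (2 ℕ.* i)))) L)
      ≡⟨ cong prodℚ (map-cong as-powers L) ⟩
    prodℚ (map (λ i → (1/ q) ^ℕ w * q ^ℕ (2 ℕ.* i)) L)
      ≡⟨ prodℚ-map-* (λ _ → (1/ q) ^ℕ w) (λ i → q ^ℕ (2 ℕ.* i)) L ⟩
    prodℚ (map (λ _ → (1/ q) ^ℕ w) L) * prodℚ (map (λ i → q ^ℕ (2 ℕ.* i)) L)
      ≡⟨ cong₂ _*_ (prodℚ-map-const ((1/ q) ^ℕ w) L) (prodℚ-map-^ℕ q (2 ℕ.*_) L) ⟩
    ((1/ q) ^ℕ w) ^ℕ length L * q ^ℕ sum (map (2 ℕ.*_) L)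
      ≡⟨ cong₂ (λ k e → ((1/ q) ^ℕ w) ^ℕ k * q ^ℕ e) (length-upTo (suc w)) (trans (sum-map-*ˡ 2 L) (2*sum-oneTo w)) ⟩
    ((1/ q) ^ℕ w) ^ℕ suc w * q ^ℕ (w ℕ.* suc w)
      ≡⟨ cong (_* q ^ℕ (w ℕ.* suc w)) (^ℕ-assocʳ (1/ q) w (suc w)) ⟩
    (1/ q) ^ℕ (w ℕ.* suc w) * q ^ℕ (w ℕ.* suc w)
      ≡⟨ ℚ.*-comm ((1/ q) ^ℕ (w ℕ.* suc w)) _ ⟩
    q ^ℕ (w ℕ.* suc w) * (1/ q) ^ℕ (w ℕ.* suc w)
      ≡⟨ ^ℕ-inverseʳ q (w ℕ.* suc w) ⟩
    1ℚ
      ∎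
    where
    open ≡-Reasoning
    L : List ℕ
    L = upTo (suc w)
    as-powers : ∀ i → (1/ q) ^ℤ ((+ w) ℤ.- (+ (2 ℕ.* i))) ≡ (1/ q) ^ℕ w * q ^ℕ (2 ℕ.* i)
    as-powers i = begin
      (1/ q) ^ℤ ((+ w) ℤ.- (+ (2 ℕ.* i))) ≡⟨ cong ((1/ q) ^ℤ_) (ℤ.[+m]-[+n]≡m⊖n w (2 ℕ.* i)) ⟩
      (1/ q) ^ℤ (w ⊖ 2 ℕ.* i)             ≡⟨ ^ℤ-⊖ (1/ q) w (2 ℕ.* i) ⟩
      (1/ q) ^ℕ w * _                     ≡⟨ cong (λ y → (1/ q) ^ℕ w * y ^ℕ (2 ℕ.* i)) (ℚ.1/-involutive q) ⟩
      (1/ q) ^ℕ w * q ^ℕ (2 ℕ.* i)        ∎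

  QEhrDen-inversion : ∀ w → QEhrDen w (1/ z) (1/ q) ≡ (- (1/ z)) ^ℕ suc w * QEhrDen w z q
  QEhrDen-inversion w = begin
    prodℚ (map (λ i → 1ℚ - (1/ q) ^ℤ e i * (1/ z)) L)
      ≡⟨ cong prodℚ (map-cong (λ i → factor-inversion (1/ z) z (q ^ℤ e i) ((1/ q) ^ℤ e i)
                                        (^ℤ-inverseˡ q (e i)) (ℚ.*-inverseʳ z)) L) ⟩
    prodℚ (map (λ i → (- (1/ z)) * ((1/ q) ^ℤ e i * (1ℚ - q ^ℤ e i * z))) L)
      ≡⟨ prodℚ-map-* (λ _ → - (1/ z)) (λ i → (1/ q) ^ℤ e i * (1ℚ - q ^ℤ e i * z)) L ⟩
    prodℚ (map (λ _ → - (1/ z)) L) * prodℚ (map (λ i → (1/ q) ^ℤ e i * (1ℚ - q ^ℤ e i * z)) L)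
      ≡⟨ cong₂ _*_ (prodℚ-map-const (- (1/ z)) L) (prodℚ-map-* (λ i → (1/ q) ^ℤ e i) (λ i → 1ℚ - q ^ℤ e i * z) L) ⟩
    (- (1/ z)) ^ℕ length L * (prodℚ (map (λ i → (1/ q) ^ℤ e i) L) * QEhrDen w z q)
      ≡⟨ cong₂ (λ k p → (- (1/ z)) ^ℕ k * (p * QEhrDen w z q)) (length-upTo (suc w)) (prodℚ-1/q^ℤ-shifts w) ⟩
    (- (1/ z)) ^ℕ suc w * (1ℚ * QEhrDen w z q)
      ≡⟨ cong ((- (1/ z)) ^ℕ suc w *_) (ℚ.*-identityˡ _) ⟩
    (- (1/ z)) ^ℕ suc w * QEhrDen w z q
      ∎
    where
    open ≡-Reasoning
    L : List ℕ
    L = upTo (suc w)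
    e : ℕ → ℤ
    e i = (+ w) ℤ.- (+ (2 ℕ.* i))

sign-cancel : ∀ z .{{_ : NonZero z}} n → (- 1ℚ) ^ℕ suc (suc n) * z ^ℕ 2 * z ^ℕ n * (- (1/ z)) ^ℕ suc (suc n) ≡ 1ℚ
sign-cancel z n = begin
  (- 1ℚ) ^ℕ m * z ^ℕ 2 * z ^ℕ n * (- (1/ z)) ^ℕ m      ≡⟨ regroup ((- 1ℚ) ^ℕ m) (z ^ℕ 2) (z ^ℕ n) ((- (1/ z)) ^ℕ m) ⟩
  (- 1ℚ) ^ℕ m * (- (1/ z)) ^ℕ m * (z ^ℕ 2 * z ^ℕ n)    ≡⟨ cong₂ _*_ (^ℕ-distrib-* (- 1ℚ) (- (1/ z)) m) (^ℕ-homo-* z 2 n) ⟨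
  ((- 1ℚ) * (- (1/ z))) ^ℕ m * z ^ℕ m                  ≡⟨ cong (λ y → y ^ℕ m * z ^ℕ m) (neg-*-neg (1/ z)) ⟩
  (1/ z) ^ℕ m * z ^ℕ m                                 ≡⟨ ℚ.*-comm ((1/ z) ^ℕ m) (z ^ℕ m) ⟩
  z ^ℕ m * (1/ z) ^ℕ m                                 ≡⟨ ^ℕ-inverseʳ z m ⟩
  1ℚ                                                   ∎
  where
  open ≡-Reasoning
  m : ℕ
  m = suc (suc n)
  regroup : ∀ s a b t → s * a * b * t ≡ s * t * (a * b)
  regroup = solve-∀ ℚ-ring
  neg-*-neg : ∀ u → (- 1ℚ) * (- u) ≡ u
  neg-*-neg = solve-∀ ℚ-ring

proposition5p10 : (w : ℕ) (μ : List ℕ) → 0 < w → IsPartition w μ →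
    (z q : ℚ) .{{_ : NonZero z}} .{{_ : NonZero q}} →
    (h₁ : QEhrDen w (1/ z) (1/ q) {{inv-nonZero q}} ≢ 0ℚ) →
    (h₂ : QEhrDen w z q ≢ 0ℚ) →
    QEhr w μ (1/ z) (1/ q) {{inv-nonZero q}} h₁
      ≡ ((- 1ℚ) ^ℕ suc w) * (z ^ℕ 2) * QEhr w (conjugate μ) z q h₂
proposition5p10 zero    μ () _ z q h₁ h₂
proposition5p10 (suc n) μ _  partition z q h₁ h₂ =
  ÷-rescale (z ^ℕ n) ((- (1/ z)) ^ℕ suc (suc n)) ((- 1ℚ) ^ℕ suc (suc n) * z ^ℕ 2)
            {{ℚ.≢-nonZero h₁}} {{ℚ.≢-nonZero h₂}}
    (sym (QEhrNum-inversion z q partition))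
    (QEhrDen-inversion z q (suc n))
    (sign-cancel z n)
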